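{- Let $G$ be a graph, $k$ a positive integer, and $A\subseteq V(G)$ with $\mathrm{sw}(A)\le k$. Then there exists a vertex $v\in V(G)$ that neighbor-controls at least $|E(A,\overline{A})|/(2k)$ edges of $E(A,\overline{A})$.
   Context: $\overline{A}=V(G)\setminus A$ and $E(A,\overline{A})$ is the set of edges of $G$ with one endpoint in $A$ and the other in $\overline{A}$. $\mathrm{sw}(A)$ is the maximum size of an induced matching $M$ of $G$ (the subgraph induced by the endpoints of $M$ has no edges besides $M$) with $M\subseteq E(A,\overline{A})$. A vertex $v$ neighbor-controls an edge $e$ if $e$ has an endpoint in the closed neighborhood $N[v]$. -}

module Defs where

open import Data.Nat using (ℕ; _≤_)
open import Data.Bool using (Bool; true; false; _∧_; _∨_; not; if_then_else_)
open import Data.Fin using (Fin; _≟_)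
open import Data.List using (List; map; allFin)
open import Data.Nat.ListAction using (sum)
open import Data.Vec using (Vec; lookup)
open import Data.Product using (_×_)
open import Data.Sum using (_⊎_)
open import Function.Definitions using (Injective)
open import Relation.Nullary using (¬_)
open import Relation.Nullary.Decidable using (⌊_⌋)
open import Relation.Binary.PropositionalEquality using (_≡_)

record Graph (n : ℕ) : Set where
  field
    adj   : Fin n → Fin n → Bool
    sym   : ∀ u v → adj u v ≡ adj v u
    irrfl : ∀ v → adj v v ≡ false
open Graph public

VSet : ℕ → Set
VSet n = Vec Bool n

inA : ∀ {n} → VSet n → Fin n → Bool
inA A v = lookup A v

sumFin : ∀ {n} → (Fin n → ℕ) → ℕ
sumFin {n} f = sum (map f (allFin n))

count : ∀ {n} → (Fin n → Bool) → ℕ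
count {n} p = sumFin (λ i → if p i then 1 else 0)

-- (u , w) represents the edge uw of E(A, Ā) with u ∈ A and w ∉ A.
-- Each edge of E(A, Ā) corresponds to exactly one such ordered pair.
cutPair : ∀ {n} → Graph n → VSet n → Fin n → Fin n → Bool
cutPair G A u w = inA A u ∧ not (inA A w) ∧ adj G u w

cutSize : ∀ {n} → Graph n → VSet n → ℕ
cutSize G A = sumFin (λ u → count (λ w → cutPair G A u w))

inClosedNbhd : ∀ {n} → Graph n → Fin n → Fin n → Bool
inClosedNbhd G v x = ⌊ v ≟ x ⌋ ∨ adj G v x

controlled : ∀ {n} → Graph n → VSet n → Fin n → ℕ
controlled G A v =
  sumFin (λ u → count (λ w → cutPair G A u w ∧
                              (inClosedNbhd G v u ∨ inClosedNbhd G v w)))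

-- a, b : Fin m → Fin n describe m edges a i b i of E(A, Ā) (a i ∈ A, b i ∉ A)
-- forming an induced matching: the 2m endpoints are pairwise distinct, and
-- every edge of G between two endpoints joins endpoints of the same matching
-- edge (so the induced subgraph on the endpoints has exactly the edges of M).
endpoint : ∀ {n m} → (Fin m → Fin n) → (Fin m → Fin n) → Fin m → Fin n → Set
endpoint a b i x = x ≡ a i ⊎ x ≡ b i

record IsInducedCutMatching {n m : ℕ} (G : Graph n) (A : VSet n)
                            (a b : Fin m → Fin n) : Set where
  field
    inCut   : ∀ i → cutPair G A (a i) (b i) ≡ true
    a-inj   : Injective _≡_ _≡_ a
    b-inj   : Injective _≡_ _≡_ b
    a≢b     : ∀ i j → ¬ (a i ≡ b j)
    induced : ∀ i j x y → endpoint a b i x → endpoint a b j y →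
              adj G x y ≡ true → i ≡ j

swAtMost : ∀ {n} → Graph n → VSet n → ℕ → Set
swAtMost {n} G A k =
  ∀ (m : ℕ) (a b : Fin m → Fin n) → IsInducedCutMatching G A a b → m ≤ k

-- Grow an induced matching M inside E(A, Ā) greedily, adding any cut edge that no
-- endpoint of M neighbor-controls; an uncontrolled edge keeps the matching induced,
-- so the process stops after at most sw(A) ≤ k steps. At that point every cut edge
-- is controlled by one of the 2|M| ≤ 2k endpoints of M, and by the union bound and
-- pigeonhole one endpoint controls at least |E(A, Ā)|/(2k) of them.
module Submission where

open import Defs renaming (sym to adj-sym)
open import Algebra.Properties.CommutativeSemigroup using (interchange)
open import Data.Bool using (Bool; true; false; _∧_; _∨_; not; if_then_else_)
open import Data.Bool.Properties using (∨-conicalˡ; ∨-conicalʳ; ∧-conicalʳ; ¬-not) renaming (_≟_ to _≟ᵇ_)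
open import Data.Bool.ListAction using (any)
open import Data.Empty using (⊥-elim)
open import Data.Fin using (Fin; zero; suc; _≟_)
open import Data.Fin.Properties using (any?)
open import Data.List using (List; []; _∷_; map; allFin; length; lookup)
open import Data.List.Extrema.Nat using (argmax; f[xs]≤f[argmax])
open import Data.List.Relation.Unary.All using (All; []; _∷_)
open import Data.Nat using (ℕ; zero; suc; _+_; _*_; _≤_; _<_; z≤n; s≤s)
open import Data.Nat.ListAction using (sum)
open import Data.Nat.Properties
  using (≤-refl; ≤-trans; ≤-reflexive; +-mono-≤; +-monoʳ-≤; *-monoˡ-≤; *-monoʳ-≤; +-suc; +-identityʳ;
         1+n≰n; +-commutativeSemigroup; module ≤-Reasoning)
open import Data.Product using (∃; ∃₂; _×_; _,_; proj₁; proj₂)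
open import Data.Sum using (_⊎_; inj₁; inj₂)
open import Relation.Nullary using (Dec; yes; no; contradiction)
open import Relation.Nullary.Decidable using (_×-dec_)
open import Relation.Binary.PropositionalEquality

sum-map-mono : ∀ {a} {X : Set a} {f g : X → ℕ} (xs : List X) →
               (∀ x → f x ≤ g x) → sum (map f xs) ≤ sum (map g xs)
sum-map-mono []       f≤g = z≤n
sum-map-mono (x ∷ xs) f≤g = +-mono-≤ (f≤g x) (sum-map-mono xs f≤g)

sum-map-+ : ∀ {a} {X : Set a} (f g : X → ℕ) (xs : List X) →
            sum (map (λ x → f x + g x) xs) ≡ sum (map f xs) + sum (map g xs)
sum-map-+ f g []       = refl
sum-map-+ f g (x ∷ xs) = trans (cong (f x + g x +_) (sum-map-+ f g xs))
                               (interchange +-commutativeSemigroup (f x) (g x) _ _)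

sum-map-zero : ∀ {a} {X : Set a} (xs : List X) → sum (map (λ _ → 0) xs) ≡ 0
sum-map-zero []       = refl
sum-map-zero (_ ∷ xs) = sum-map-zero xs

sum-map≤length* : ∀ {a} {X : Set a} {f : X → ℕ} {c : ℕ} {xs : List X} →
                  All (λ x → f x ≤ c) xs → sum (map f xs) ≤ length xs * c
sum-map≤length* []           = z≤n
sum-map≤length* (fx≤c ∷ f≤c) = +-mono-≤ fx≤c (sum-map≤length* f≤c)

sum-map≤length*argmax : ∀ {a} {X : Set a} (f : X → ℕ) (x₀ : X) (xs : List X) →
                        ∃ λ x → sum (map f xs) ≤ length xs * f x
sum-map≤length*argmax f x₀ xs = argmax f x₀ xs , sum-map≤length* (f[xs]≤f[argmax] x₀ xs)

indicator : Bool → ℕ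
indicator b = if b then 1 else 0

indicator-∨ : ∀ a b → indicator (a ∨ b) ≤ indicator a + indicator b
indicator-∨ true  b     = s≤s z≤n
indicator-∨ false true  = ≤-refl
indicator-∨ false false = z≤n

count-mono : ∀ {n} (p q : Fin n → Bool) →
             (∀ i → indicator (p i) ≤ indicator (q i)) → count p ≤ count q
count-mono {n} p q p≤q = sum-map-mono (allFin n) p≤q

count-subadditive : ∀ {n} (p q r : Fin n → Bool) →
                    (∀ i → indicator (p i) ≤ indicator (q i) + indicator (r i)) →
                    count p ≤ count q + count r
count-subadditive {n} p q r p≤q+r = ≤-trans
  (sum-map-mono (allFin n) p≤q+r)
  (≤-reflexive (sum-map-+ (λ i → indicator (q i)) (λ i → indicator (r i)) (allFin n)))

-- cutSize G A and controlled G A v are definitionally instances of pairCount.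
pairCount : ∀ {n} → (Fin n → Fin n → Bool) → ℕ
pairCount p = sumFin (λ u → count (p u))

pairCount-mono : ∀ {n} (p q : Fin n → Fin n → Bool) →
                 (∀ u w → indicator (p u w) ≤ indicator (q u w)) → pairCount p ≤ pairCount q
pairCount-mono {n} p q p≤q = sum-map-mono (allFin n) λ u → count-mono (p u) (q u) (p≤q u)

pairCount-subadditive : ∀ {n} (p q r : Fin n → Fin n → Bool) →
                        (∀ u w → indicator (p u w) ≤ indicator (q u w) + indicator (r u w)) →
                        pairCount p ≤ pairCount q + pairCount r
pairCount-subadditive {n} p q r p≤q+r = ≤-trans
  (sum-map-mono (allFin n) λ u → count-subadditive (p u) (q u) (r u) (p≤q+r u))
  (≤-reflexive (sum-map-+ (λ u → count (q u)) (λ u → count (r u)) (allFin n)))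

pairCount-false : ∀ {n} → pairCount {n} (λ _ _ → false) ≡ 0
pairCount-false {n} = trans (cong (λ c → sum (map (λ _ → c) (allFin n))) (sum-map-zero (allFin n)))
                            (sum-map-zero (allFin n))

pairCount-any : ∀ {a} {X : Set a} {n} (f : X → Fin n → Fin n → Bool) (xs : List X) →
                pairCount (λ u w → any (λ x → f x u w) xs) ≤ sum (map (λ x → pairCount (f x)) xs)
pairCount-any {n = n} f []       = ≤-reflexive (pairCount-false {n})
pairCount-any f (x ∷ xs) = ≤-trans
  (pairCount-subadditive _ (f x) (λ u w → any (λ y → f y u w) xs)
     λ u w → indicator-∨ (f x u w) _)
  (+-monoʳ-≤ (pairCount (f x)) (pairCount-any f xs))

module InducedCutMatching {n : ℕ} (G : Graph n) (A : VSet n) where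

  cut : Fin n → Fin n → Bool
  cut = cutPair G A

  controls : Fin n → Fin n → Fin n → Bool
  controls v u w = inClosedNbhd G v u ∨ inClosedNbhd G v w

  Matching : Set
  Matching = List (Fin n × Fin n)

  left right : (M : Matching) → Fin (length M) → Fin n
  left  M i = proj₁ (lookup M i)
  right M i = proj₂ (lookup M i)

  IsInduced : Matching → Set
  IsInduced M = IsInducedCutMatching G A (left M) (right M)

  endpoints : Matching → List (Fin n)
  endpoints []            = []
  endpoints ((a , b) ∷ M) = a ∷ b ∷ endpoints M

  length-endpoints : ∀ M → length (endpoints M) ≡ 2 * length M
  length-endpoints []      = refl
  length-endpoints (_ ∷ M) = cong suc (trans (cong suc (length-endpoints M))
                                             (sym (+-suc (length M) (length M + 0))))

  controlledBy : Matching → Fin n → Fin n → Bool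
  controlledBy M u w = any (λ v → controls v u w) (endpoints M)

  IsMaximal : Matching → Set
  IsMaximal M = ∀ u w → cut u w ≡ true → controlledBy M u w ≡ true

  []-isInduced : IsInduced []
  []-isInduced = record
    { inCut = λ () ; a-inj = λ {} ; b-inj = λ {} ; a≢b = λ () ; induced = λ () }

  adj⇒≢ : ∀ {x y} → adj G x y ≡ true → x ≢ y
  adj⇒≢ {x} adj-xy refl with trans (sym (irrfl G x)) adj-xy
  ... | ()

  ∉N[]⇒≢×¬adj : ∀ {v x} → inClosedNbhd G v x ≡ false → v ≢ x × adj G v x ≡ false
  ∉N[]⇒≢×¬adj {v} {x} x∉N[v] with v ≟ x
  ... | no v≢x = v≢x , x∉N[v]

  uncontrolled⇒far : ∀ {x y} M → controlledBy M x y ≡ false →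
                     ∀ i {z t} → endpoint (left M) (right M) i z → t ≡ x ⊎ t ≡ y →
                     z ≢ t × adj G z t ≡ false
  uncontrolled⇒far {x} {y} ((a , b) ∷ M) free zero {z} {t} z-end t-end =
    ∉N[]⇒≢×¬adj (t∉N[z] z-end t-end)
    where
    a-free = ∨-conicalˡ (controls a x y) _ free
    b-free = ∨-conicalˡ (controls b x y) _ (∨-conicalʳ (controls a x y) _ free)
    t∉N[z] : endpoint (left ((a , b) ∷ M)) (right ((a , b) ∷ M)) zero z →
             t ≡ x ⊎ t ≡ y → inClosedNbhd G z t ≡ false
    t∉N[z] (inj₁ refl) (inj₁ refl) = ∨-conicalˡ (inClosedNbhd G a x) _ a-free
    t∉N[z] (inj₁ refl) (inj₂ refl) = ∨-conicalʳ (inClosedNbhd G a x) _ a-free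
    t∉N[z] (inj₂ refl) (inj₁ refl) = ∨-conicalˡ (inClosedNbhd G b x) _ b-free
    t∉N[z] (inj₂ refl) (inj₂ refl) = ∨-conicalʳ (inClosedNbhd G b x) _ b-free
  uncontrolled⇒far {x} {y} ((a , b) ∷ M) free (suc i) =
    uncontrolled⇒far M (∨-conicalʳ (controls b x y) _ (∨-conicalʳ (controls a x y) _ free)) i

  extend : ∀ {x y} M → IsInduced M → cut x y ≡ true → controlledBy M x y ≡ false →
           IsInduced ((x , y) ∷ M)
  extend {x} {y} M M-induced xy-cut xy-free = record
    { inCut   = λ { zero → xy-cut ; (suc i) → inCut i }
    ; a-inj   = a-inj′
    ; b-inj   = b-inj′
    ; a≢b     = a≢b′
    ; induced = induced′
    }
    where
    open IsInducedCutMatching M-induced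
    M′ = (x , y) ∷ M
    far = uncontrolled⇒far M xy-free

    a-inj′ : ∀ {i j} → left M′ i ≡ left M′ j → i ≡ j
    a-inj′ {zero}  {zero}  _ = refl
    a-inj′ {zero}  {suc j} e = contradiction (sym e) (proj₁ (far j (inj₁ refl) (inj₁ refl)))
    a-inj′ {suc i} {zero}  e = contradiction e (proj₁ (far i (inj₁ refl) (inj₁ refl)))
    a-inj′ {suc i} {suc j} e = cong suc (a-inj e)

    b-inj′ : ∀ {i j} → right M′ i ≡ right M′ j → i ≡ j
    b-inj′ {zero}  {zero}  _ = refl
    b-inj′ {zero}  {suc j} e = contradiction (sym e) (proj₁ (far j (inj₂ refl) (inj₂ refl)))
    b-inj′ {suc i} {zero}  e = contradiction e (proj₁ (far i (inj₂ refl) (inj₂ refl)))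
    b-inj′ {suc i} {suc j} e = cong suc (b-inj e)

    a≢b′ : ∀ i j → left M′ i ≢ right M′ j
    a≢b′ zero    zero    = adj⇒≢ (∧-conicalʳ (not (inA A y)) _ (∧-conicalʳ (inA A x) _ xy-cut))
    a≢b′ zero    (suc j) e = proj₁ (far j (inj₂ refl) (inj₁ refl)) (sym e)
    a≢b′ (suc i) zero    e = proj₁ (far i (inj₁ refl) (inj₂ refl)) e
    a≢b′ (suc i) (suc j) = a≢b i j

    induced′ : ∀ i j u w → endpoint (left M′) (right M′) i u → endpoint (left M′) (right M′) j w →
               adj G u w ≡ true → i ≡ j
    induced′ zero    zero    _ _ _    _    _   = refl
    induced′ zero    (suc j) u w u-end w-end uw
      with trans (sym (proj₂ (far j w-end u-end))) (trans (adj-sym G w u) uw)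
    ... | ()
    induced′ (suc i) zero    u w u-end w-end uw
      with trans (sym (proj₂ (far i u-end w-end))) uw
    ... | ()
    induced′ (suc i) (suc j) u w u-end w-end uw = cong suc (induced i j u w u-end w-end uw)

  uncontrolled-cut-pair? : ∀ M → Dec (∃₂ λ u w → cut u w ≡ true × controlledBy M u w ≡ false)
  uncontrolled-cut-pair? M =
    any? λ u → any? λ w → (cut u w ≟ᵇ true) ×-dec (controlledBy M u w ≟ᵇ false)

  -- The fuel d is the number of edges that may still be added before sw(A) ≤ k is violated.
  greedy : ∀ {k} → swAtMost G A k → ∀ d M → IsInduced M → length M + d ≡ k →
           ∃ λ M′ → length M′ ≤ k × IsMaximal M′
  greedy sw d M M-induced |M|+d≡k with uncontrolled-cut-pair? M
  ... | no none =
    M , sw _ _ _ M-induced , λ u w uw-cut → ¬-not λ uw-free → none (u , w , uw-cut , uw-free)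
  ... | yes (x , y , xy-cut , xy-free) with d
  ...   | zero  = ⊥-elim (1+n≰n (≤-trans (sw _ _ _ (extend M M-induced xy-cut xy-free))
                                         (≤-reflexive (trans (sym |M|+d≡k) (+-identityʳ _)))))
  ...   | suc d = greedy sw d ((x , y) ∷ M) (extend M M-induced xy-cut xy-free)
                         (trans (sym (+-suc (length M) d)) |M|+d≡k)

  maximal-induced-matching : ∀ {k} → swAtMost G A k → ∃ λ M → length M ≤ k × IsMaximal M
  maximal-induced-matching sw = greedy sw _ [] []-isInduced refl

  maximal⇒cutSize≤ : ∀ M → IsMaximal M →
                     cutSize G A ≤ pairCount (λ u w → any (λ v → cut u w ∧ controls v u w) (endpoints M))
  maximal⇒cutSize≤ M maximal = pairCount-mono (cutPair G A) _ cut⇒controlled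
    where
    cut⇒controlled : ∀ u w → indicator (cut u w) ≤
                             indicator (any (λ v → cut u w ∧ controls v u w) (endpoints M))
    cut⇒controlled u w with cut u w in uw-cut
    ... | false = z≤n
    ... | true rewrite maximal u w uw-cut = ≤-refl

lemma13 : ∀ {n : ℕ} (G : Graph n) (k : ℕ) (A : VSet n) →
    0 < k → 0 < n → swAtMost G A k →
    ∃ λ (v : Fin n) → cutSize G A ≤ 2 * k * controlled G A v
lemma13 {suc n} G k A _ _ sw =
  let (M , |M|≤k , maximal) = maximal-induced-matching sw
      (v , pigeonhole)      = sum-map≤length*argmax (controlled G A) zero (endpoints M)
  in v , (begin
    cutSize G A
      ≤⟨ maximal⇒cutSize≤ M maximal ⟩
    pairCount (λ u w → any (λ z → cut u w ∧ controls z u w) (endpoints M))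
      ≤⟨ pairCount-any (λ z u w → cut u w ∧ controls z u w) (endpoints M) ⟩
    sum (map (controlled G A) (endpoints M))
      ≤⟨ pigeonhole ⟩
    length (endpoints M) * controlled G A v
      ≡⟨ cong (_* controlled G A v) (length-endpoints M) ⟩
    2 * length M * controlled G A v
      ≤⟨ *-monoˡ-≤ (controlled G A v) (*-monoʳ-≤ 2 |M|≤k) ⟩
    2 * k * controlled G A v ∎)
  where
  open InducedCutMatching G A
  open ≤-Reasoning
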